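{- Let $P$ be a finite ordered set (not necessarily $N$-free) having a minimal element $a$ such that $a$ is not maximal in $P$ and every upper cover of $a$ is minimal in $P\setminus\{a\}$. Then $|\mathcal{G}(P)|=|\mathcal{G}(P\setminus\{a\})|$.
   Context: $y$ is an upper cover of $x$ if $x<y$ and no $z$ satisfies $x<z<y$. $P\setminus\{a\}$ denotes the induced suborder on the remaining elements. For a finite ordered set $Q$, $U(x)=\{v: x<v\}$, and a linear extension $L=x_1<\cdots<x_n$ of $Q$ is greedy if: $x_1$ is minimal in $Q$; having chosen $x_1,\dots,x_i$, if no element of $U(x_i)$ is minimal in $Q\setminus\{x_1,\dots,x_i\}$ (in particular if $U(x_i)=\varnothing$), then $x_{i+1}$ is any minimal element of $Q\setminus\{x_1,\dots,x_i\}$; otherwise $x_{i+1}$ is an element of $U(x_i)$ minimal in $Q\setminus\{x_1,\dots,x_i\}$. $\mathcal{G}(Q)$ is the set of greedy linear extensions of $Q$. -}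

module Defs where

open import Level using (0ℓ)
open import Data.Nat using (ℕ)
open import Data.Fin using (Fin; _≟_)
open import Data.Fin.Base using ()
open import Data.List using (List; []; _∷_; allFin)
open import Data.Bool.ListAction using (all; any)
open import Data.Bool using (Bool; true; false; _∧_; not; if_then_else_; T)
open import Data.Maybe using (Maybe; nothing; just)
open import Data.Product using (Σ; ∃; _×_)
open import Relation.Binary using (Rel; Decidable)
open import Relation.Binary.PropositionalEquality using (_≡_; _≢_)
open import Relation.Nullary.Decidable using (⌊_⌋)
open import Relation.Nullary using (¬_)

-- Sub-ordered sets are
-- given by a Boolean predicate Q on Fin n, carrying the induced order.

module _ {n : ℕ} {_≤_ : Rel (Fin n) 0ℓ} where

  _<_ : Rel (Fin n) 0ℓ
  x < y = (x ≤ y) × (x ≢ y)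

  IsMinimal : Fin n → Set
  IsMinimal a = ∀ y → y ≤ a → y ≡ a

  IsMaximal : Fin n → Set
  IsMaximal a = ∀ y → a ≤ y → y ≡ a

  IsUpperCover : Fin n → Fin n → Set
  IsUpperCover x y = (x < y) × ¬ (∃ λ z → (x < z) × (z < y))

  IsMinimalWithout : Fin n → Fin n → Set
  IsMinimalWithout a y = (y ≢ a) × (∀ z → z ≢ a → z ≤ y → z ≡ y)

module Greedy {n : ℕ} {_≤_ : Rel (Fin n) 0ℓ} (_≤?_ : Decidable _≤_) where

  _<ᵇ_ : Fin n → Fin n → Bool
  x <ᵇ y = ⌊ x ≤? y ⌋ ∧ not ⌊ x ≟ y ⌋

  -- elements of Q not yet chosen (S = the chosen prefix)
  Remaining : (Fin n → Bool) → List (Fin n) → Fin n → Bool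
  Remaining Q S x = Q x ∧ not (any (λ y → ⌊ x ≟ y ⌋) S)

  isMinimalIn : (Fin n → Bool) → Fin n → Bool
  isMinimalIn R x = R x ∧ all (λ y → not (R y ∧ (y <ᵇ x))) (allFin n)

  stepOK : (Fin n → Bool) → Maybe (Fin n) → List (Fin n) → Fin n → Bool
  stepOK Q nothing S x = isMinimalIn (Remaining Q S) x
  stepOK Q (just p) S x =
    if any (λ v → (p <ᵇ v) ∧ isMinimalIn (Remaining Q S) v) (allFin n)
    then (p <ᵇ x) ∧ isMinimalIn (Remaining Q S) x
    else isMinimalIn (Remaining Q S) x

  greedyFrom : (Fin n → Bool) → Maybe (Fin n) → List (Fin n) → List (Fin n) → Bool
  greedyFrom Q prev S [] = all (λ x → not (Remaining Q S x)) (allFin n)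
  greedyFrom Q prev S (x ∷ L) = stepOK Q prev S x ∧ greedyFrom Q (just x) (x ∷ S) L

  -- 𝒢(Q): the set of greedy linear extensions of the suborder Q
  -- (T b is a proposition, so this Σ-type has exactly |𝒢(Q)| elements)
  𝒢 : (Fin n → Bool) → Set
  𝒢 Q = Σ (List (Fin n)) (λ L → T (greedyFrom Q nothing [] L))

  whole : Fin n → Bool
  whole _ = true

  without : Fin n → Fin n → Bool
  without a x = not ⌊ x ≟ a ⌋

module Submission where

-- In a greedy extension L of P, nothing above a can precede a, and
-- immediately after a the greedy rule must pick an element of U(a): an upper
-- cover of a is minimal in P ∖ {a}, hence available.  So L is obtained from
-- the list del L (L with a deleted) by inserting a just before the first
-- element above a (the map ins).  Conversely, inserting a in this way into a
-- greedy extension of P ∖ {a} gives a greedy extension of P.  Hence del and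
-- ins are mutually inverse bijections 𝒢(P) ↔ 𝒢(P ∖ {a}).

open import Defs
open import Level using (0ℓ)
open import Data.Nat using (ℕ)
open import Data.Fin using (Fin; _≟_)
open import Data.Fin.Properties using (any?)
open import Data.Bool using (Bool; true; false; _∧_; not; T)
open import Data.Bool.Properties using (T-∧; T-≡; T-irrelevant; ∧-assoc; ∧-comm)
open import Data.Bool.ListAction using (all; any)
open import Data.List using (List; []; _∷_; allFin; filter)
open import Data.List.Properties using (filter-accept; filter-reject; filter-all)
open import Data.List.Membership.Propositional using (_∈_; lose)
open import Data.List.Membership.Propositional.Properties using (∈-allFin)
open import Data.List.Relation.Unary.All as All using (All; []; _∷_)
open import Data.List.Relation.Unary.All.Properties using (all⁺; all⁻)
open import Data.List.Relation.Unary.Any using (here; there; satisfied)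
open import Data.List.Relation.Unary.Any.Properties using (any⁺; any⁻)
open import Data.Maybe using (Maybe; nothing; just)
open import Data.Maybe.Properties using (just-injective)
open import Data.Product using (∃; _×_; _,_; proj₁; proj₂)
open import Data.Product.Properties using (Σ-≡,≡→≡)
open import Data.Unit using (tt)
open import Data.Empty using (⊥)
open import Function.Base using (_∘_; const)
open import Function.Bundles using (_↔_; _⇔_; mk⇔; mk↔ₛ′; Equivalence)
open import Relation.Binary using (Rel; Decidable; IsPartialOrder)
open import Relation.Binary.PropositionalEquality
  using (_≡_; _≢_; _≗_; refl; sym; trans; cong; subst; ≢-sym; module ≡-Reasoning)
open import Relation.Nullary using (¬_; Dec; yes; no; contradiction; ¬?; _×-dec_)
open import Relation.Nullary.Decidable using (⌊_⌋; decidable-stable)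

open Equivalence using (to; from)

module GreedyExtensions {n : ℕ} {_≤_ : Rel (Fin n) 0ℓ}
                        (po : IsPartialOrder _≡_ _≤_) (_≤?_ : Decidable _≤_) where

  open IsPartialOrder po using (antisym) renaming (trans to ≤-trans)
  open Greedy _≤?_

  _⊏_ : Rel (Fin n) 0ℓ
  _⊏_ = _<_ {_≤_ = _≤_}

  ⊏-irrefl : ∀ {x} → ¬ x ⊏ x
  ⊏-irrefl (_ , x≢x) = x≢x refl

  ⊏⇒≢ : ∀ {x y} → x ⊏ y → y ≢ x
  ⊏⇒≢ x⊏y refl = ⊏-irrefl x⊏y

  ⊏-trans : ∀ {x y z} → x ⊏ y → y ⊏ z → x ⊏ z
  ⊏-trans (x≤y , x≢y) (y≤z , _) = ≤-trans x≤y y≤z , λ { refl → x≢y (antisym x≤y y≤z) }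

  _⊏?_ : Decidable _⊏_
  x ⊏? y = (x ≤? y) ×-dec ¬? (x ≟ y)

  -- Subsets of P are Boolean predicates, as in Defs.  R ∖ x has the same
  -- shape as Remaining, so Remaining (without a) [] is literally
  -- Remaining whole [] ∖ a.
  Subset : Set
  Subset = Fin n → Bool

  -- Membership, wrapped in a record so that x and R can be inferred from it.
  record _∈ₛ_ (x : Fin n) (R : Subset) : Set where
    constructor member
    field holds : T (R x)
  open _∈ₛ_

  _∖_ : Subset → Fin n → Subset
  (R ∖ x) y = not ⌊ y ≟ x ⌋ ∧ R y

  ∈-∖⁻ : ∀ {R x y} → y ∈ₛ (R ∖ x) → y ≢ x × y ∈ₛ R
  ∈-∖⁻ {x = x} {y} (member y∈) with y ≟ x
  ... | no y≢x = y≢x , member y∈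

  ∈-∖⁺ : ∀ {R x y} → y ≢ x → y ∈ₛ R → y ∈ₛ (R ∖ x)
  ∈-∖⁺ {R} {x} {y} y≢x (member y∈) = member (kept (y ≟ x))
    where
    kept : (y≟x : Dec (y ≡ x)) → T (not ⌊ y≟x ⌋ ∧ R y)
    kept (no _)     = y∈
    kept (yes y≡x)  = contradiction y≡x y≢x

  ∖-comm : ∀ R x y → (R ∖ x) ∖ y ≗ (R ∖ y) ∖ x
  ∖-comm R x y z = begin
    not ⌊ z ≟ y ⌋ ∧ (not ⌊ z ≟ x ⌋ ∧ R z)  ≡⟨ sym (∧-assoc (not ⌊ z ≟ y ⌋) _ _) ⟩
    (not ⌊ z ≟ y ⌋ ∧ not ⌊ z ≟ x ⌋) ∧ R z  ≡⟨ cong (_∧ R z) (∧-comm (not ⌊ z ≟ y ⌋) _) ⟩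
    (not ⌊ z ≟ x ⌋ ∧ not ⌊ z ≟ y ⌋) ∧ R z  ≡⟨ ∧-assoc (not ⌊ z ≟ x ⌋) _ _ ⟩
    not ⌊ z ≟ x ⌋ ∧ (not ⌊ z ≟ y ⌋ ∧ R z)  ∎
    where open ≡-Reasoning

  Minimal : Subset → Fin n → Set
  Minimal R x = x ∈ₛ R × (∀ y → y ∈ₛ R → ¬ y ⊏ x)

  UpperMinimal : Subset → Fin n → Set
  UpperMinimal R q = ∃ λ v → q ⊏ v × Minimal R v

  GreedyStep : Subset → Maybe (Fin n) → Fin n → Set
  GreedyStep R p x = Minimal R x × (∀ {q} → p ≡ just q → UpperMinimal R q → q ⊏ x)

  Empty : Subset → Set
  Empty R = ∀ x → ¬ x ∈ₛ R

  data IsGreedy : Subset → Maybe (Fin n) → List (Fin n) → Set where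
    done : ∀ {R p} → Empty R → IsGreedy R p []
    _∷_  : ∀ {R p x L} → GreedyStep R p x → IsGreedy (R ∖ x) (just x) L → IsGreedy R p (x ∷ L)

  module _ {R R′ : Subset} (R≗R′ : R ≗ R′) where

    ∈-resp : ∀ {x} → x ∈ₛ R → x ∈ₛ R′
    ∈-resp {x} (member x∈) = member (subst T (R≗R′ x) x∈)

    ∈-resp⁻ : ∀ {x} → x ∈ₛ R′ → x ∈ₛ R
    ∈-resp⁻ {x} (member x∈) = member (subst T (sym (R≗R′ x)) x∈)

    minimal-resp⁻ : ∀ {x} → Minimal R′ x → Minimal R x
    minimal-resp⁻ (x∈ , least) = ∈-resp⁻ x∈ , λ y → least y ∘ ∈-resp

  minimal-resp : ∀ {R R′} → R ≗ R′ → ∀ {x} → Minimal R x → Minimal R′ x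
  minimal-resp R≗R′ = minimal-resp⁻ (sym ∘ R≗R′)

  greedyStep-resp : ∀ {R R′} → R ≗ R′ → ∀ {p x} → GreedyStep R p x → GreedyStep R′ p x
  greedyStep-resp R≗R′ (m , follows) = minimal-resp R≗R′ m ,
    λ { p≡q (v , q⊏v , mv) → follows p≡q (v , q⊏v , minimal-resp⁻ R≗R′ mv) }

  isGreedy-resp : ∀ {R R′} → R ≗ R′ → ∀ {p L} → IsGreedy R p L → IsGreedy R′ p L
  isGreedy-resp R≗R′ (done empty) = done λ x → empty x ∘ ∈-resp⁻ R≗R′
  isGreedy-resp R≗R′ (_∷_ {x = x} s g) =
    greedyStep-resp R≗R′ s ∷ isGreedy-resp (λ y → cong (not ⌊ y ≟ x ⌋ ∧_) (R≗R′ y)) g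

  T-not : ∀ {b} → T (not b) ⇔ (¬ T b)
  T-not {true}  = mk⇔ (λ ()) (λ ¬t → ¬t tt)
  T-not {false} = mk⇔ (λ _ ()) (const tt)

  all-allFin : ∀ {p : Fin n → Bool} → T (all p (allFin n)) ⇔ (∀ x → T (p x))
  all-allFin {p} = mk⇔ (λ t x → All.lookup (all⁺ p (allFin n) t) (∈-allFin x))
                       (λ h → all⁻ p (All.tabulate {xs = allFin n} λ {x} _ → h x))

  any-allFin : ∀ {p : Fin n → Bool} → T (any p (allFin n)) ⇔ ∃ λ x → T (p x)
  any-allFin {p} = mk⇔ (satisfied ∘ any⁻ p (allFin n)) (λ (x , px) → any⁺ p (lose (∈-allFin x) px))

  <ᵇ-reflects : ∀ {x y} → T (x <ᵇ y) ⇔ x ⊏ y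
  <ᵇ-reflects {x} {y} with x ≤? y | x ≟ y
  ... | yes x≤y | no x≢y  = mk⇔ (const (x≤y , x≢y)) (const tt)
  ... | yes _   | yes x≡y = mk⇔ (λ ()) (λ (_ , x≢y) → x≢y x≡y)
  ... | no x≰y  | _       = mk⇔ (λ ()) (λ (x≤y , _) → x≰y x≤y)

  minimal-reflects : ∀ {R x} → T (isMinimalIn R x) ⇔ Minimal R x
  minimal-reflects {R} {x} = mk⇔
    (λ t → let x∈ , none = to (T-∧ {R x}) t in
      member x∈ , λ y (member y∈) y⊏x →
        to T-not (to all-allFin none y) (from T-∧ (y∈ , from <ᵇ-reflects y⊏x)))
    (λ (member x∈ , least) → from T-∧ (x∈ , from all-allFin λ y → from T-not λ t →
      let y∈ , y⊏x = to (T-∧ {R y}) t in least y (member y∈) (to <ᵇ-reflects y⊏x)))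

  upperMinimal-reflects : ∀ {R q} →
    T (any (λ v → (q <ᵇ v) ∧ isMinimalIn R v) (allFin n)) ⇔ UpperMinimal R q
  upperMinimal-reflects {R} {q} = mk⇔
    (λ t → let v , s = to any-allFin t ; q⊏v , m = to (T-∧ {q <ᵇ v}) s in
      v , to <ᵇ-reflects q⊏v , to minimal-reflects m)
    (λ (v , q⊏v , m) → from any-allFin (v , from T-∧ (from <ᵇ-reflects q⊏v , from minimal-reflects m)))

  step-reflects : ∀ Q p S x → T (stepOK Q p S x) ⇔ GreedyStep (Remaining Q S) p x
  step-reflects Q nothing S x = mk⇔ (λ t → to minimal-reflects t , λ ()) (from minimal-reflects ∘ proj₁)
  step-reflects Q (just q) S x with any (λ v → (q <ᵇ v) ∧ isMinimalIn (Remaining Q S) v) (allFin n) in up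
  ... | true = mk⇔
    (λ t → let q⊏x , m = to (T-∧ {q <ᵇ x}) t in to minimal-reflects m , λ { refl _ → to <ᵇ-reflects q⊏x })
    (λ (m , follows) → from T-∧
      (from <ᵇ-reflects (follows refl (to upperMinimal-reflects (from T-≡ up))) , from minimal-reflects m))
  ... | false = mk⇔
    (λ t → to minimal-reflects t , λ { refl u → contradiction (from upperMinimal-reflects u) (subst T up) })
    (from minimal-reflects ∘ proj₁)

  remaining-∷ : ∀ Q S x → Remaining Q (x ∷ S) ≗ Remaining Q S ∖ x
  remaining-∷ Q S x y with Q y | ⌊ y ≟ x ⌋
  ... | true  | true  = refl
  ... | true  | false = refl
  ... | false | true  = refl
  ... | false | false = refl

  greedy-reflects : ∀ Q p S L → T (greedyFrom Q p S L) ⇔ IsGreedy (Remaining Q S) p L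
  greedy-reflects Q p S [] = mk⇔
    (λ t → done λ x → to T-not (to all-allFin t x) ∘ holds)
    (λ { (done empty) → from all-allFin λ x → from T-not (empty x ∘ member) })
  greedy-reflects Q p S (x ∷ L) = mk⇔
    (λ t → let s , g = to (T-∧ {stepOK Q p S x}) t in
      to (step-reflects Q p S x) s ∷ isGreedy-resp (remaining-∷ Q S x) (to rest g))
    (λ { (s ∷ g) → from T-∧ (from (step-reflects Q p S x) s ,
                              from rest (isGreedy-resp (sym ∘ remaining-∷ Q S x) g)) })
    where
    rest : T (greedyFrom Q (just x) (x ∷ S) L) ⇔ IsGreedy (Remaining Q (x ∷ S)) (just x) L
    rest = greedy-reflects Q (just x) (x ∷ S) L

  greedy-⊆ : ∀ {R p L} → IsGreedy R p L → All (_∈ₛ R) L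
  greedy-⊆ (done _) = []
  greedy-⊆ ((m , _) ∷ g) = proj₁ m ∷ All.map (proj₂ ∘ ∈-∖⁻) (greedy-⊆ g)

  -- Only the first step of a greedy list refers to the previous element.
  greedy-retarget : ∀ {R p p′ L} → (∀ {x} → GreedyStep R p′ x → GreedyStep R p x) →
                    IsGreedy R p′ L → IsGreedy R p L
  greedy-retarget f (done empty) = done empty
  greedy-retarget f (s ∷ g) = f s ∷ g

  minimal-∖⁺ : ∀ {R v z} → Minimal R v → v ≢ z → Minimal (R ∖ z) v
  minimal-∖⁺ (v∈ , least) v≢z = ∈-∖⁺ v≢z v∈ , λ y → least y ∘ proj₂ ∘ ∈-∖⁻

  minimal-∖⁻ : ∀ {R v z} → Minimal (R ∖ z) v → ¬ z ⊏ v → Minimal R v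
  minimal-∖⁻ {R} {v} {z} (v∈ , least) z⋢v = proj₂ (∈-∖⁻ v∈) , below
    where
    below : ∀ y → y ∈ₛ R → ¬ y ⊏ v
    below y y∈ with y ≟ z
    ... | yes refl = z⋢v
    ... | no y≢z = least y (∈-∖⁺ y≢z y∈)

  minimal-exists : ∀ {A : Fin n → Set} → (∀ x → Dec (A x)) → ∃ A →
                   ∃ λ v → A v × (∀ z → A z → ¬ z ⊏ v)
  minimal-exists {A} A? (x , ax) =
    let v , av , least = scan (allFin n) in v , av , λ z → least (∈-allFin z)
    where
    scan : ∀ xs → ∃ λ v → A v × (∀ {z} → z ∈ xs → A z → ¬ z ⊏ v)
    scan [] = x , ax , λ ()
    scan (y ∷ ys) with scan ys
    ... | v , av , least with A? y ×-dec y ⊏? v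
    ...   | yes (ay , y⊏v) = y , ay ,
            λ { (here refl) _ → ⊏-irrefl ; (there z∈) az z⊏y → least z∈ az (⊏-trans z⊏y y⊏v) }
    ...   | no ¬ay×y⊏v = v , av ,
            λ { (here refl) az z⊏v → ¬ay×y⊏v (az , z⊏v) ; (there z∈) → least z∈ }

module RemovingAMinimalElement
    {n : ℕ} {_≤_ : Rel (Fin n) 0ℓ} (po : IsPartialOrder _≡_ _≤_) (_≤?_ : Decidable _≤_)
    (a : Fin n) (a-minimal : IsMinimal {_≤_ = _≤_} a) (a-not-maximal : ¬ IsMaximal {_≤_ = _≤_} a)
    (covers-minimal : ∀ y → IsUpperCover {_≤_ = _≤_} a y → IsMinimalWithout {_≤_ = _≤_} a y)
    where

  open Greedy _≤?_
  open GreedyExtensions po _≤?_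

  nothing-below-a : ∀ {q} → ¬ q ⊏ a
  nothing-below-a (q≤a , q≢a) = q≢a (a-minimal _ q≤a)

  -- a has an upper cover: U(a) is nonempty and, P being finite, has a minimal element.
  a-cover : ∃ λ v → IsUpperCover {_≤_ = _≤_} a v
  a-cover =
    let v , a⊏v , least = minimal-exists (a ⊏?_) above-a
    in v , a⊏v , λ (z , a⊏z , z⊏v) → least z a⊏z z⊏v
    where
    above-a : ∃ (a ⊏_)
    above-a with any? (a ⊏?_)
    ... | yes found = found
    ... | no none = contradiction
      (λ y a≤y → decidable-stable (y ≟ a) λ y≢a → none (y , a≤y , y≢a ∘ sym)) a-not-maximal

  -- The invariant of a greedy run before a is chosen: nothing above a is chosen yet.
  ContainsUpset : Subset → Set
  ContainsUpset R = ∀ z → a ⊏ z → z ∈ₛ R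

  containsUpset-∖ : ∀ {R x} → ContainsUpset R → ¬ a ⊏ x → ContainsUpset (R ∖ x)
  containsUpset-∖ up a⋢x z a⊏z = ∈-∖⁺ (λ { refl → a⋢x a⊏z }) (up z a⊏z)

  minimal-not-above-a : ∀ {R x} → a ∈ₛ R → Minimal R x → ¬ a ⊏ x
  minimal-not-above-a a∈ (_ , least) = least _ a∈

  module _ {R : Subset} (up : ContainsUpset R) where

    -- A minimal element of R ∖ {a} above a is an upper cover of a, hence
    -- (by hypothesis) minimal in P ∖ {a}: no q ≠ a lies below it.
    below-cover : ∀ {q v} → q ≢ a → q ⊏ v → a ⊏ v → Minimal (R ∖ a) v → ⊥
    below-cover {q} {v} q≢a (q≤v , q≢v) a⊏v (_ , least) = q≢v (proj₂ (covers-minimal v cover) q q≢a q≤v)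
      where
      cover : IsUpperCover {_≤_ = _≤_} a v
      cover = a⊏v , λ (w , a⊏w , w⊏v) → least w (∈-∖⁺ (⊏⇒≢ a⊏w) (up w a⊏w)) w⊏v

    upperMinimal-∖a⁻ : ∀ {q} → q ≢ a → UpperMinimal (R ∖ a) q → UpperMinimal R q
    upperMinimal-∖a⁻ q≢a (v , q⊏v , m) = v , q⊏v , minimal-∖⁻ m λ a⊏v → below-cover q≢a q⊏v a⊏v m

    -- Right after a, the greedy rule forces an element of U(a).
    a-upperMinimal : UpperMinimal (R ∖ a) a
    a-upperMinimal =
      let v , cover = a-cover ; v≢a , least = covers-minimal v cover ; a⊏v = proj₁ cover
      in v , a⊏v , ∈-∖⁺ v≢a (up v a⊏v) ,
         λ w w∈ (w≤v , w≢v) → w≢v (least w (proj₁ (∈-∖⁻ w∈)) w≤v)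

  -- Elements of U(q) are never a, so removing a keeps them minimal.
  upperMinimal-∖a⁺ : ∀ {R q} → UpperMinimal R q → UpperMinimal (R ∖ a) q
  upperMinimal-∖a⁺ (v , q⊏v , m) = v , q⊏v , minimal-∖⁺ m λ { refl → nothing-below-a q⊏v }

  step-∖a : ∀ {R p x} → ContainsUpset R → p ≢ just a → x ≢ a →
            GreedyStep R p x → GreedyStep (R ∖ a) p x
  step-∖a up p≢a x≢a (m , follows) =
    minimal-∖⁺ m x≢a , λ { refl u → follows refl (upperMinimal-∖a⁻ up (p≢a ∘ cong just) u) }

  step-∖a⁻ : ∀ {R p x} → ¬ a ⊏ x → GreedyStep (R ∖ a) p x → GreedyStep R p x
  step-∖a⁻ a⋢x (m , follows) = minimal-∖⁻ m a⋢x , λ p≡q u → follows p≡q (upperMinimal-∖a⁺ u)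

  step-skip-a : ∀ {R p c} → ContainsUpset R → p ≢ just a → GreedyStep R p a →
                GreedyStep (R ∖ a) (just a) c → GreedyStep (R ∖ a) p c
  step-skip-a up p≢a (_ , a-follows) (m , _) =
    m , λ { refl u → contradiction (a-follows refl (upperMinimal-∖a⁻ up (p≢a ∘ cong just) u)) nothing-below-a }

  step-a : ∀ {R p} → a ∈ₛ R → (∀ {q} → p ≡ just q → ¬ UpperMinimal (R ∖ a) q) → GreedyStep R p a
  step-a a∈ idle = (a∈ , λ _ _ → nothing-below-a) , λ p≡q u → contradiction (upperMinimal-∖a⁺ u) (idle p≡q)

  _≢a? : ∀ x → Dec (x ≢ a)
  x ≢a? = ¬? (x ≟ a)

  del : List (Fin n) → List (Fin n)
  del = filter _≢a?

  ins : List (Fin n) → List (Fin n)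
  ins [] = a ∷ []
  ins (x ∷ L) with a ⊏? x
  ... | yes _ = a ∷ x ∷ L
  ... | no _  = x ∷ ins L

  ins-skip : ∀ {x L} → ¬ a ⊏ x → ins (x ∷ L) ≡ x ∷ ins L
  ins-skip {x} a⋢x with a ⊏? x
  ... | yes a⊏x = contradiction a⊏x a⋢x
  ... | no _    = refl

  del-ins : ∀ {L} → All (_≢ a) L → del (ins L) ≡ L
  del-ins [] = filter-reject _≢a? λ a≢a → a≢a refl
  del-ins {x ∷ L} (x≢a ∷ rest) with a ⊏? x
  ... | yes _ = trans (filter-reject _≢a? λ a≢a → a≢a refl) (filter-all _≢a? (x≢a ∷ rest))
  ... | no _  = trans (filter-accept _≢a? x≢a) (cong (x ∷_) (del-ins rest))

  avoids-a : ∀ {R p L} → IsGreedy (R ∖ a) p L → All (_≢ a) L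
  avoids-a g = All.map (proj₁ ∘ ∈-∖⁻) (greedy-⊆ g)

  -- After a, the next element lies in U(a), so ins puts a back in front.
  ins-after-a : ∀ {R L} → ContainsUpset R → IsGreedy (R ∖ a) (just a) L → ins L ≡ a ∷ L
  ins-after-a up (done _) = refl
  ins-after-a up (_∷_ {x = x} (_ , follows) _) with a ⊏? x
  ... | yes _    = refl
  ... | no a⋢x = contradiction (follows refl (a-upperMinimal up)) a⋢x

  deletion : ∀ {R p L} → a ∈ₛ R → ContainsUpset R → p ≢ just a → IsGreedy R p L →
             IsGreedy (R ∖ a) p (del L) × ins (del L) ≡ L
  deletion a∈ up p≢a (done empty) = contradiction a∈ (empty a)
  deletion {R} {p} {x ∷ L} a∈ up p≢a (s ∷ g) with x ≟ a
  ... | yes refl rewrite filter-all _≢a? (avoids-a g) =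
    greedy-retarget (step-skip-a up p≢a s) g , ins-after-a up g
  ... | no x≢a =
    let g′ , ins-del = deletion (∈-∖⁺ (≢-sym x≢a) a∈) (containsUpset-∖ up a⋢x) (x≢a ∘ just-injective) g
    in step-∖a up p≢a x≢a s ∷ isGreedy-resp (∖-comm R x a) g′ ,
       trans (ins-skip a⋢x) (cong (x ∷_) ins-del)
    where
    a⋢x : ¬ a ⊏ x
    a⋢x = minimal-not-above-a a∈ (proj₁ s)

  insertion : ∀ {R p L} → a ∈ₛ R → ContainsUpset R → p ≢ just a →
              IsGreedy (R ∖ a) p L → IsGreedy R p (ins L)
  insertion a∈ up p≢a (done empty) =
    step-a a∈ (λ { _ (_ , _ , v∈ , _) → empty _ v∈ }) ∷ done empty
  insertion {R} {p} {x ∷ L} a∈ up p≢a (s ∷ g) with a ⊏? x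
  ... | yes a⊏x = step-a a∈ idle ∷ ((proj₁ s , λ { refl _ → a⊏x }) ∷ g)
    where
    idle : ∀ {q} → p ≡ just q → ¬ UpperMinimal (R ∖ a) q
    idle refl u = below-cover up (p≢a ∘ cong just) (proj₂ s refl u) a⊏x (proj₁ s)
  ... | no a⋢x =
    step-∖a⁻ a⋢x s ∷
      insertion (∈-∖⁺ (≢-sym x≢a) a∈) (containsUpset-∖ up a⋢x) (x≢a ∘ just-injective)
                (isGreedy-resp (∖-comm R a x) g)
    where
    x≢a : x ≢ a
    x≢a = proj₁ (∈-∖⁻ (proj₁ (proj₁ s)))

  -- Greedy extensions of P and of P ∖ {a} as runs on Remaining whole [] and
  -- on Remaining (without a) [], which is Remaining whole [] ∖ a by computation.
  greedy-P : (G : 𝒢 whole) → IsGreedy (Remaining whole []) nothing (proj₁ G)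
  greedy-P (L , t) = to (greedy-reflects whole nothing [] L) t

  greedy-P∖a : (G : 𝒢 (without a)) → IsGreedy (Remaining whole [] ∖ a) nothing (proj₁ G)
  greedy-P∖a (L , t) = to (greedy-reflects (without a) nothing [] L) t

  ≡-by-list : ∀ {Q} {G G′ : 𝒢 Q} → proj₁ G ≡ proj₁ G′ → G ≡ G′
  ≡-by-list L≡L′ = Σ-≡,≡→≡ (L≡L′ , T-irrelevant _ _)

  bijection : 𝒢 whole ↔ 𝒢 (without a)
  bijection = mk↔ₛ′ forward backward
    (λ G → ≡-by-list (del-ins (avoids-a (greedy-P∖a G))))
    (λ G → ≡-by-list (proj₂ (delete G)))
    where
    delete : (G : 𝒢 whole) → let L = proj₁ G in
             IsGreedy (Remaining whole [] ∖ a) nothing (del L) × ins (del L) ≡ L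
    delete G = deletion _ (λ _ _ → _) (λ ()) (greedy-P G)

    forward : 𝒢 whole → 𝒢 (without a)
    forward G = del (proj₁ G) , from (greedy-reflects (without a) nothing [] _) (proj₁ (delete G))

    backward : 𝒢 (without a) → 𝒢 whole
    backward G = ins (proj₁ G) ,
      from (greedy-reflects whole nothing [] _) (insertion _ (λ _ _ → _) (λ ()) (greedy-P∖a G))

mainTheorem9 : (n : ℕ) (_≤_ : Rel (Fin n) 0ℓ) → IsPartialOrder _≡_ _≤_ → (_≤?_ : Decidable _≤_) →
    (a : Fin n) → IsMinimal {_≤_ = _≤_} a → ¬ IsMaximal {_≤_ = _≤_} a →
    (∀ y → IsUpperCover {_≤_ = _≤_} a y → IsMinimalWithout {_≤_ = _≤_} a y) →
    Greedy.𝒢 _≤?_ (Greedy.whole _≤?_) ↔ Greedy.𝒢 _≤?_ (Greedy.without _≤?_ a)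
mainTheorem9 n _≤_ po _≤?_ a a-minimal a-not-maximal covers-minimal =
  RemovingAMinimalElement.bijection po _≤?_ a a-minimal a-not-maximal covers-minimal
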